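{- Let $t:\mathsf{State}$ be a closed term of $\mathcal{T}_{\mathrm{Class}}$ of state $\varnothing$ and let $s$ be any state constant. Define state constants $s_0:=s$ and $s_{n+1}:=$ the normal form of $s_n\sqcup t[s_n]$. Then there exists $n$ such that $t[s_n]=\varnothing$ in $\mathcal{T}_{\mathrm{Learn}}$.
   Context: Gödel's system $\mathcal{T}$: simply typed $\lambda$-calculus with atomic types $\mathbb{N},\mathsf{Bool}$, products, arrows, $0,\mathsf{S},\mathsf{True},\mathsf{False}$, conditionals, recursors in all types, pairing and projections; numerals are $\mathsf{S}^n(0)$. A $k$-ary predicate of $\mathcal{T}$ is a closed normal term $\mathbb{N}^k\to\mathsf{Bool}$. An atom is $\langle P,\vec n,m\rangle$ with $P$ a $(k+1)$-ary predicate, $\vec n,m$ numerals, $P\vec nm=\mathsf{True}$; atoms $\langle P,\vec n,m\rangle,\langle P',\vec n',m'\rangle$ are consistent if $P=P'$ and $\vec n=\vec n'$ imply $m=m'$; a state is a finite set of pairwise consistent atoms; $S_1\uplus S_2$ is $S_1\cup S_2$ minus the atoms of $S_2$ inconsistent with some atom of $S_1$. $\mathcal{T}_{\mathrm{State}}$ extends $\mathcal{T}$ by an atomic type $\mathsf{State}$ and a constant $s$ for each state $|s|$; $\varnothing$ is the constant for the empty state. For each $(k+1)$-ary predicate $P$: constants $\mathsf{X}_P:\mathbb{N}^k\to\mathsf{Bool}$, $\Phi_P:\mathbb{N}^k\to\mathbb{N}$, $\mathsf{Add}_P:\mathbb{N}^{k+1}\to\mathsf{State}$ (no reduction rules), $\chi_P,\varphi_P,\mathsf{add}_P$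 (same types with an extra first argument of type $\mathsf{State}$), and $\sqcup:\mathsf{State}\to\mathsf{State}\to\mathsf{State}$. $\mathcal{T}_{\mathrm{Class}}=\mathcal{T}_{\mathrm{State}}+\{\mathsf{X}_P,\Phi_P,\mathsf{Add}_P,\sqcup\}$; $\mathcal{T}_{\mathrm{Learn}}=\mathcal{T}_{\mathrm{State}}+\{\chi_P,\varphi_P,\mathsf{add}_P,\sqcup\}$ with reductions: $\chi_Ps\vec n\mapsto\mathsf{True}$ if some $\langle P,\vec n,m\rangle\in|s|$, else $\mathsf{False}$; $\varphi_Ps\vec n\mapsto m$ if $\langle P,\vec n,m\rangle\in|s|$, else $0$; $\mathsf{add}_Ps\vec nm\mapsto\varnothing$ if some $\langle P,\vec n,l\rangle\in|s|$ or $P\vec nm=\mathsf{False}$, else the constant for $\{\langle P,\vec n,m\rangle\}$; $s_1\sqcup s_2\mapsto$ the constant for $|s_1|\uplus|s_2|$. $\mathcal{T}_{\mathrm{Learn}}$ is strongly normalizing and closed terms of type $\mathsf{State}$ normalize to state constants. $t[s]$ replaces $\mathsf{X}_P,\Phi_P,\mathsf{Add}_P$ by $\chi_Ps,\varphi_Ps,\mathsf{add}_Ps$. A term has state $\varnothing$ if it contains no state constant other than $\varnothing$. -}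

module Defs where

open import Data.Bool using (Bool; true; false)
open import Data.Nat using (ℕ; zero; suc)
open import Data.Vec using (Vec; []; _∷_; _∷ʳ_)
open import Data.List using (List; []; _∷_; _++_)
open import Data.List.Membership.Propositional using (_∈_)
open import Data.List.Relation.Unary.AllPairs using (AllPairs; []; _∷_)
open import Data.List.Relation.Unary.All using ([])
open import Data.Product using (Σ; _×_; _,_; proj₁; ∃; ∃-syntax; Σ-syntax)
open import Data.Sum using (_⊎_)
open import Data.Unit using (⊤)
open import Data.Empty using (⊥)
open import Relation.Nullary using (¬_)
open import Relation.Binary.PropositionalEquality using (_≡_; _≢_)
open import Relation.Binary.Construct.Closure.ReflexiveTransitive using (Star)

-- Types.  Ty false = types of Gödel's T;  Ty true = types of T_State
-- (which additionally has the atomic type State).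

infixr 7 _⇒_
infixr 8 _⊗_

data Ty : Bool → Set where
  nat bool : ∀ {σ} → Ty σ
  state    : Ty true
  _⇒_ _⊗_  : ∀ {σ} → Ty σ → Ty σ → Ty σ

Ctx : Bool → Set
Ctx σ = List (Ty σ)

data _∋_ {σ : Bool} : Ctx σ → Ty σ → Set where
  here  : ∀ {Γ A} → (A ∷ Γ) ∋ A
  there : ∀ {Γ A B} → Γ ∋ A → (B ∷ Γ) ∋ A

infixr 7 _⇒ⁿ_
_⇒ⁿ_ : ∀ {σ} → ℕ → Ty σ → Ty σ
zero  ⇒ⁿ A = A
suc k ⇒ⁿ A = nat ⇒ (k ⇒ⁿ A)

data Prim {σ : Bool} : Ty σ → Set where
  ‵0      : Prim nat
  ‵S      : Prim (nat ⇒ nat)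
  ‵True   : Prim bool
  ‵False  : Prim bool
  ‵if     : ∀ {A} → Prim (bool ⇒ A ⇒ A ⇒ A)
  ‵R      : ∀ {A} → Prim (A ⇒ (nat ⇒ A ⇒ A) ⇒ nat ⇒ A)
  ‵pair   : ∀ {A B} → Prim (A ⇒ B ⇒ A ⊗ B)
  ‵π₀     : ∀ {A B} → Prim (A ⊗ B ⇒ A)
  ‵π₁     : ∀ {A B} → Prim (A ⊗ B ⇒ B)

module _ {σ : Bool} (C : Ty σ → Set) where

  data Tm (Γ : Ctx σ) : Ty σ → Set where
    var  : ∀ {A} → Γ ∋ A → Tm Γ A
    lam  : ∀ {A B} → Tm (A ∷ Γ) B → Tm Γ (A ⇒ B)
    app  : ∀ {A B} → Tm Γ (A ⇒ B) → Tm Γ A → Tm Γ B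
    prim : ∀ {A} → Prim A → Tm Γ A
    con  : ∀ {A} → C A → Tm Γ A

module _ {σ : Bool} {C : Ty σ → Set} where

  Ren : Ctx σ → Ctx σ → Set
  Ren Γ Δ = ∀ {A} → Γ ∋ A → Δ ∋ A

  ext : ∀ {Γ Δ B} → Ren Γ Δ → Ren (B ∷ Γ) (B ∷ Δ)
  ext ρ here      = here
  ext ρ (there x) = there (ρ x)

  ren : ∀ {Γ Δ A} → Ren Γ Δ → Tm C Γ A → Tm C Δ A
  ren ρ (var x)   = var (ρ x)
  ren ρ (lam t)   = lam (ren (ext ρ) t)
  ren ρ (app t u) = app (ren ρ t) (ren ρ u)
  ren ρ (prim p)  = prim p
  ren ρ (con c)   = con c

  Sub : Ctx σ → Ctx σ → Set
  Sub Γ Δ = ∀ {A} → Γ ∋ A → Tm C Δ A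

  exts : ∀ {Γ Δ B} → Sub Γ Δ → Sub (B ∷ Γ) (B ∷ Δ)
  exts θ here      = var here
  exts θ (there x) = ren there (θ x)

  sub : ∀ {Γ Δ A} → Sub Γ Δ → Tm C Γ A → Tm C Δ A
  sub θ (var x)   = θ x
  sub θ (lam t)   = lam (sub (exts θ) t)
  sub θ (app t u) = app (sub θ t) (sub θ u)
  sub θ (prim p)  = prim p
  sub θ (con c)   = con c

  sub₁ : ∀ {Γ B} → Tm C Γ B → Sub (B ∷ Γ) Γ
  sub₁ u here      = u
  sub₁ u (there x) = var x

  _[_] : ∀ {Γ A B} → Tm C (B ∷ Γ) A → Tm C Γ B → Tm C Γ A
  t [ u ] = sub (sub₁ u) t

  num : ∀ {Γ} → ℕ → Tm C Γ nat
  num zero    = prim ‵0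
  num (suc n) = app (prim ‵S) (num n)

  appNums : ∀ {Γ A k} → Tm C Γ (k ⇒ⁿ A) → Vec ℕ k → Tm C Γ A
  appNums t []       = t
  appNums t (n ∷ ns) = appNums (app t (num n)) ns

  AllCon : (∀ {A} → C A → Set) → ∀ {Γ A} → Tm C Γ A → Set
  AllCon Q (var x)   = ⊤
  AllCon Q (lam t)   = AllCon Q t
  AllCon Q (app t u) = AllCon Q t × AllCon Q u
  AllCon Q (prim p)  = ⊤
  AllCon Q (con c)   = Q c

mapCon : ∀ {σ} {C D : Ty σ → Set} → (∀ {Γ A} → C A → Tm D Γ A)
       → ∀ {Γ A} → Tm C Γ A → Tm D Γ A
mapCon f (var x)   = var x
mapCon f (lam t)   = lam (mapCon f t)
mapCon f (app t u) = app (mapCon f t) (mapCon f u)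
mapCon f (prim p)  = prim p
mapCon f (con c)   = f c

module Red {σ : Bool} (C : Ty σ → Set)
           (δ : ∀ {Γ A} → Tm C Γ A → Tm C Γ A → Set) where

  infix 4 _⟶_ _↠_

  data _⟶_ {Γ : Ctx σ} : ∀ {A} → Tm C Γ A → Tm C Γ A → Set where
    β    : ∀ {A B} {t : Tm C (A ∷ Γ) B} {u : Tm C Γ A}
         → app (lam t) u ⟶ t [ u ]
    ifT  : ∀ {A} {u v : Tm C Γ A}
         → app (app (app (prim ‵if) (prim ‵True)) u) v ⟶ u
    ifF  : ∀ {A} {u v : Tm C Γ A}
         → app (app (app (prim ‵if) (prim ‵False)) u) v ⟶ v
    R0   : ∀ {A} {u : Tm C Γ A} {v : Tm C Γ (nat ⇒ A ⇒ A)}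
         → app (app (app (prim ‵R) u) v) (prim ‵0) ⟶ u
    RS   : ∀ {A} {u : Tm C Γ A} {v : Tm C Γ (nat ⇒ A ⇒ A)} {n : Tm C Γ nat}
         → app (app (app (prim ‵R) u) v) (app (prim ‵S) n)
           ⟶ app (app v n) (app (app (app (prim ‵R) u) v) n)
    π₀β  : ∀ {A B} {u : Tm C Γ A} {v : Tm C Γ B}
         → app (prim ‵π₀) (app (app (prim ‵pair) u) v) ⟶ u
    π₁β  : ∀ {A B} {u : Tm C Γ A} {v : Tm C Γ B}
         → app (prim ‵π₁) (app (app (prim ‵pair) u) v) ⟶ v
    δ⟶   : ∀ {A} {t u : Tm C Γ A} → δ t u → t ⟶ u
    ξlam : ∀ {A B} {t t' : Tm C (A ∷ Γ) B} → _⟶_ {A ∷ Γ} t t' → lam t ⟶ lam t'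
    ξappₗ : ∀ {A B} {t t' : Tm C Γ (A ⇒ B)} {u : Tm C Γ A}
          → t ⟶ t' → app t u ⟶ app t' u
    ξappᵣ : ∀ {A B} {t : Tm C Γ (A ⇒ B)} {u u' : Tm C Γ A}
          → u ⟶ u' → app t u ⟶ app t u'

  _↠_ : ∀ {Γ A} → Tm C Γ A → Tm C Γ A → Set
  _↠_ = Star _⟶_

C₀ : Ty false → Set
C₀ _ = ⊥

δ₀ : ∀ {Γ A} → Tm C₀ Γ A → Tm C₀ Γ A → Set
δ₀ _ _ = ⊥

Tm₀ : Ctx false → Ty false → Set
Tm₀ = Tm C₀

open Red C₀ δ₀ public using () renaming (_⟶_ to _⟶₀_; _↠_ to _↠₀_)

Normal₀ : ∀ {Γ A} → Tm₀ Γ A → Set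
Normal₀ t = ∀ {u} → ¬ (t ⟶₀ u)

record Pred (k : ℕ) : Set where
  constructor pred
  field
    term    : Tm₀ [] (k ⇒ⁿ bool)
    .normal : Normal₀ term
open Pred public

record Atom : Set where
  constructor ⟨_,_,_⟩∣_
  field
    {ar}   : ℕ
    P      : Pred (suc ar)
    args   : Vec ℕ ar
    val    : ℕ
    .holds : appNums (term P) (args ∷ʳ val) ↠₀ prim ‵True
open Atom public

Key : Set
Key = Σ ℕ λ k → Tm₀ [] (suc k ⇒ⁿ bool) × Vec ℕ k

key : Atom → Key
key a = ar a , term (P a) , args a

Consistent : Atom → Atom → Set
Consistent a b = key a ≡ key b → val a ≡ val b

Inconsistent : Atom → Atom → Set
Inconsistent a b = key a ≡ key b × val a ≢ val b

record State : Set where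
  constructor mkState
  field
    atoms       : List Atom
    .consistent : AllPairs Consistent atoms
open State public

∅ : State
∅ = mkState [] []

singleton : Atom → State
singleton a = mkState (a ∷ []) ([] ∷ [])

data Filt (L₁ : List Atom) : List Atom → List Atom → Set where
  fnil : Filt L₁ [] []
  keep : ∀ {a L₂ R} → ¬ (∃[ b ] (b ∈ L₁ × Inconsistent b a))
       → Filt L₁ L₂ R → Filt L₁ (a ∷ L₂) (a ∷ R)
  drop : ∀ {a L₂ R} → ∃[ b ] (b ∈ L₁ × Inconsistent b a)
       → Filt L₁ L₂ R → Filt L₁ (a ∷ L₂) R

HasKey : State → Key → Set
HasKey s κ = ∃[ a ] (a ∈ atoms s × key a ≡ κ)

data ConstClass : Ty true → Set where
  st   : State → ConstClass state
  ‵X   : ∀ {k} → Pred (suc k) → ConstClass (k ⇒ⁿ bool)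
  ‵Φ   : ∀ {k} → Pred (suc k) → ConstClass (k ⇒ⁿ nat)
  ‵Add : ∀ {k} → Pred (suc k) → ConstClass (suc k ⇒ⁿ state)
  ‵⊔   : ConstClass (state ⇒ state ⇒ state)

data ConstLearn : Ty true → Set where
  st   : State → ConstLearn state
  ‵χ   : ∀ {k} → Pred (suc k) → ConstLearn (state ⇒ k ⇒ⁿ bool)
  ‵φ   : ∀ {k} → Pred (suc k) → ConstLearn (state ⇒ k ⇒ⁿ nat)
  ‵add : ∀ {k} → Pred (suc k) → ConstLearn (state ⇒ suc k ⇒ⁿ state)
  ‵⊔   : ConstLearn (state ⇒ state ⇒ state)

TmClass TmLearn : Ctx true → Ty true → Set
TmClass = Tm ConstClass
TmLearn = Tm ConstLearn

data LearnStep {Γ : Ctx true} : ∀ {A} → TmLearn Γ A → TmLearn Γ A → Set where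
  χ-yes : ∀ {k} {P : Pred (suc k)} {s : State} {ns : Vec ℕ k}
        → HasKey s (k , term P , ns)
        → LearnStep (appNums (app (con (‵χ P)) (con (st s))) ns) (prim ‵True)
  χ-no  : ∀ {k} {P : Pred (suc k)} {s : State} {ns : Vec ℕ k}
        → ¬ HasKey s (k , term P , ns)
        → LearnStep (appNums (app (con (‵χ P)) (con (st s))) ns) (prim ‵False)
  φ-yes : ∀ {k} {P : Pred (suc k)} {s : State} {ns : Vec ℕ k} {a : Atom}
        → a ∈ atoms s → key a ≡ (k , term P , ns)
        → LearnStep (appNums (app (con (‵φ P)) (con (st s))) ns) (num (val a))
  φ-no  : ∀ {k} {P : Pred (suc k)} {s : State} {ns : Vec ℕ k}
        → ¬ HasKey s (k , term P , ns)
        → LearnStep (appNums (app (con (‵φ P)) (con (st s))) ns) (prim ‵0)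
  add-∅ : ∀ {k} {P : Pred (suc k)} {s : State} {ns : Vec ℕ k} {m : ℕ}
        → HasKey s (k , term P , ns) ⊎ (appNums (term P) (ns ∷ʳ m) ↠₀ prim ‵False)
        → LearnStep (appNums (app (con (‵add P)) (con (st s))) (ns ∷ʳ m)) (con (st ∅))
  add-new : ∀ {k} {P : Pred (suc k)} {s : State} {ns : Vec ℕ k} {m : ℕ}
        → ¬ HasKey s (k , term P , ns)
        → (h : appNums (term P) (ns ∷ʳ m) ↠₀ prim ‵True)
        → LearnStep (appNums (app (con (‵add P)) (con (st s))) (ns ∷ʳ m))
                    (con (st (singleton (⟨ P , ns , m ⟩∣ h))))
  join  : ∀ {s₁ s₂ : State} {R : List Atom}
        → Filt (atoms s₁) (atoms s₂) R
        → .(c : AllPairs Consistent (atoms s₁ ++ R))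
        → LearnStep (app (app (con ‵⊔) (con (st s₁))) (con (st s₂)))
                    (con (st (mkState (atoms s₁ ++ R) c)))

open Red ConstLearn LearnStep public using () renaming (_⟶_ to _⟶L_; _↠_ to _↠L_)

instC : State → ∀ {Γ A} → ConstClass A → TmLearn Γ A
instC s (st s')   = con (st s')
instC s (‵X P)    = app (con (‵χ P)) (con (st s))
instC s (‵Φ P)    = app (con (‵φ P)) (con (st s))
instC s (‵Add P)  = app (con (‵add P)) (con (st s))
instC s ‵⊔        = con ‵⊔

_⟦_⟧ : ∀ {Γ A} → TmClass Γ A → State → TmLearn Γ A
t ⟦ s ⟧ = mapCon (instC s) t

EmptyStateConst : ∀ {A} → ConstClass A → Set
EmptyStateConst (st s) = atoms s ≡ []
EmptyStateConst _      = ⊤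

HasStateEmpty : ∀ {Γ A} → TmClass Γ A → Set
HasStateEmpty = AllCon EmptyStateConst

data Iter (t : TmClass [] state) (s : State) : ℕ → State → Set where
  base : Iter t s zero s
  step : ∀ {n sₙ s'} → Iter t s n sₙ
       → app (app (con ‵⊔) (con (st sₙ))) (t ⟦ sₙ ⟧) ↠L con (st s')
       → Iter t s (suc n) s'

-- By a reducibility argument, every closed term t of T_Class with empty state
-- is continuous in the state: there is a decision tree, querying finitely many keys (P, n⃗)
-- of the state, whose leaf at s is the state t[s] reduces to.  The same induction shows that
-- t[s] only proposes atoms whose keys are unknown to s.  Along the learning sequence
-- s₀ ⊆ s₁ ⊆ … the answer to a query changes at most once, so induction on the tree yields
-- an m at which the proposal e of t[sₘ] is stalled: either some atom of e has a key known
-- to sₘ, or no atom of e is learned by sₘ₊₁ = sₘ ⊔ e.  As sₘ ⊔ e keeps every atom of e with a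
-- key new to sₘ, both alternatives force e = ∅.

module Submission where

open import Defs
open import Data.Bool using (Bool; true; false)
open import Data.Empty using (⊥-elim)
open import Data.List using (List; []; _∷_; _++_)
open import Data.List.Membership.Propositional using (_∈_; find; lose)
open import Data.List.Membership.Propositional.Properties using (∈-++⁺ˡ; ∈-++⁺ʳ; ∈-++⁻)
open import Data.List.Relation.Unary.All as All using (All; []; _∷_)
open import Data.List.Relation.Unary.AllPairs using (AllPairs; []; _∷_)
import Data.List.Relation.Unary.AllPairs.Properties as AllPairs
open import Data.List.Relation.Unary.Any using (here; there; any?)
open import Data.Maybe using (Maybe; just; nothing; is-just; fromMaybe)
open import Data.Nat using (ℕ; zero; suc; _≤′_; ≤′-refl; ≤′-step) renaming (_≟_ to _≟ℕ_)
open import Data.Nat.Properties using (≤′-trans)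
open import Data.Product using (Σ; _×_; _,_; proj₁; proj₂; ∃; ∃-syntax)
import Data.Product.Properties as Product
open import Data.Sum using (_⊎_; inj₁; inj₂)
open import Data.Unit using (⊤)
open import Data.Vec using (Vec; []; _∷_; _∷ʳ_; initLast)
import Data.Vec.Properties as Vec
open import Function using (_∘_; case_of_)
open import Relation.Binary.Construct.Closure.ReflexiveTransitive using (ε; _◅_; _◅◅_; gmap)
open import Relation.Binary.Definitions using (DecidableEquality)
open import Relation.Binary.PropositionalEquality
  using (_≡_; refl; sym; trans; cong; cong₂; subst; module ≡-Reasoning)
open import Relation.Nullary using (¬_; Dec; yes; no)
open import Relation.Nullary.Decidable using (map′; recompute)

-- Renaming and substitution

infix 4 _≐_
_≐_ : ∀ {σ} {Γ : Ctx σ} {F : Ty σ → Set} (f g : ∀ {A} → Γ ∋ A → F A) → Set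
f ≐ g = ∀ {A} (x : _ ∋ A) → f x ≡ g x

module _ {σ : Bool} {C : Ty σ → Set} where

  ext-cong : ∀ {Γ Δ B} {ρ ρ′ : Ren {C = C} Γ Δ} →
             ρ ≐ ρ′ → ext {C = C} {B = B} ρ ≐ ext {C = C} ρ′
  ext-cong e here      = refl
  ext-cong e (there x) = cong there (e x)

  ren-cong : ∀ {Γ Δ A} {ρ ρ′ : Ren {C = C} Γ Δ} →
             ρ ≐ ρ′ → (t : Tm C Γ A) → ren ρ t ≡ ren ρ′ t
  ren-cong e (var x)   = cong var (e x)
  ren-cong e (lam t)   = cong lam (ren-cong (ext-cong e) t)
  ren-cong e (app t u) = cong₂ app (ren-cong e t) (ren-cong e u)
  ren-cong e (prim p)  = refl
  ren-cong e (con c)   = refl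

  exts-cong : ∀ {Γ Δ B} {θ θ′ : Sub {C = C} Γ Δ} → θ ≐ θ′ → exts {B = B} θ ≐ exts θ′
  exts-cong e here      = refl
  exts-cong e (there x) = cong (ren there) (e x)

  sub-cong : ∀ {Γ Δ A} {θ θ′ : Sub {C = C} Γ Δ} →
             θ ≐ θ′ → (t : Tm C Γ A) → sub θ t ≡ sub θ′ t
  sub-cong e (var x)   = e x
  sub-cong e (lam t)   = cong lam (sub-cong (exts-cong e) t)
  sub-cong e (app t u) = cong₂ app (sub-cong e t) (sub-cong e u)
  sub-cong e (prim p)  = refl
  sub-cong e (con c)   = refl

  ren-ren : ∀ {Γ Δ Ε A} (ρ₁ : Ren {C = C} Δ Ε) (ρ₂ : Ren {C = C} Γ Δ) (t : Tm C Γ A) →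
            ren ρ₁ (ren ρ₂ t) ≡ ren (ρ₁ ∘ ρ₂) t
  ren-ren ρ₁ ρ₂ (var x)   = refl
  ren-ren ρ₁ ρ₂ (lam t)   = cong lam (trans (ren-ren (ext ρ₁) (ext ρ₂) t)
                                            (ren-cong (λ { here → refl ; (there x) → refl }) t))
  ren-ren ρ₁ ρ₂ (app t u) = cong₂ app (ren-ren ρ₁ ρ₂ t) (ren-ren ρ₁ ρ₂ u)
  ren-ren ρ₁ ρ₂ (prim p)  = refl
  ren-ren ρ₁ ρ₂ (con c)   = refl

  sub-ren : ∀ {Γ Δ Ε A} (θ : Sub {C = C} Δ Ε) (ρ : Ren {C = C} Γ Δ) (t : Tm C Γ A) →
            sub θ (ren ρ t) ≡ sub (θ ∘ ρ) t
  sub-ren θ ρ (var x)   = refl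
  sub-ren θ ρ (lam t)   = cong lam (trans (sub-ren (exts θ) (ext ρ) t)
                                          (sub-cong (λ { here → refl ; (there x) → refl }) t))
  sub-ren θ ρ (app t u) = cong₂ app (sub-ren θ ρ t) (sub-ren θ ρ u)
  sub-ren θ ρ (prim p)  = refl
  sub-ren θ ρ (con c)   = refl

  ren-sub : ∀ {Γ Δ Ε A} (ρ : Ren {C = C} Δ Ε) (θ : Sub {C = C} Γ Δ) (t : Tm C Γ A) →
            ren ρ (sub θ t) ≡ sub (ren ρ ∘ θ) t
  ren-sub ρ θ (var x)   = refl
  ren-sub ρ θ (lam t)   = cong lam (trans (ren-sub (ext ρ) (exts θ) t) (sub-cong ext-exts t))
    where
    ext-exts : ∀ {B} → ren (ext {B = B} ρ) ∘ exts θ ≐ exts (ren ρ ∘ θ)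
    ext-exts here      = refl
    ext-exts (there x) = trans (ren-ren (ext ρ) there (θ x)) (sym (ren-ren there ρ (θ x)))
  ren-sub ρ θ (app t u) = cong₂ app (ren-sub ρ θ t) (ren-sub ρ θ u)
  ren-sub ρ θ (prim p)  = refl
  ren-sub ρ θ (con c)   = refl

  sub-sub : ∀ {Γ Δ Ε A} (θ₁ : Sub {C = C} Δ Ε) (θ₂ : Sub {C = C} Γ Δ) (t : Tm C Γ A) →
            sub θ₁ (sub θ₂ t) ≡ sub (sub θ₁ ∘ θ₂) t
  sub-sub θ₁ θ₂ (var x)   = refl
  sub-sub θ₁ θ₂ (lam t)   = cong lam (trans (sub-sub (exts θ₁) (exts θ₂) t) (sub-cong exts-exts t))
    where
    exts-exts : ∀ {B} → sub (exts {B = B} θ₁) ∘ exts θ₂ ≐ exts (sub θ₁ ∘ θ₂)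
    exts-exts here      = refl
    exts-exts (there x) = trans (sub-ren (exts θ₁) there (θ₂ x)) (sym (ren-sub there θ₁ (θ₂ x)))
  sub-sub θ₁ θ₂ (app t u) = cong₂ app (sub-sub θ₁ θ₂ t) (sub-sub θ₁ θ₂ u)
  sub-sub θ₁ θ₂ (prim p)  = refl
  sub-sub θ₁ θ₂ (con c)   = refl

  sub-var : ∀ {Γ A} (t : Tm C Γ A) → sub var t ≡ t
  sub-var (var x)   = refl
  sub-var (lam t)   = cong lam (trans (sub-cong (λ { here → refl ; (there x) → refl }) t) (sub-var t))
  sub-var (app t u) = cong₂ app (sub-var t) (sub-var u)
  sub-var (prim p)  = refl
  sub-var (con c)   = refl

  infixr 5 _∷ₛ_
  _∷ₛ_ : ∀ {Γ Δ B} → Tm C Δ B → Sub {C = C} Γ Δ → Sub (B ∷ Γ) Δ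
  (u ∷ₛ θ) here      = u
  (u ∷ₛ θ) (there x) = θ x

  sub-exts-[] : ∀ {Γ Δ A B} (θ : Sub {C = C} Γ Δ) (u : Tm C Δ B) (t : Tm C (B ∷ Γ) A) →
                sub (exts θ) t [ u ] ≡ sub (u ∷ₛ θ) t
  sub-exts-[] θ u t = trans (sub-sub (sub₁ u) (exts θ) t) (sub-cong sub₁-exts t)
    where
    sub₁-exts : sub (sub₁ u) ∘ exts θ ≐ u ∷ₛ θ
    sub₁-exts here      = refl
    sub₁-exts (there x) = trans (sub-ren (sub₁ u) there (θ x)) (sub-var (θ x))

module MapCon {σ : Bool} {C D : Ty σ → Set} (f : ∀ {Γ A} → C A → Tm D Γ A)
  (ren-f : ∀ {Γ Δ A} (ρ : Ren {C = D} Γ Δ) (c : C A) → ren ρ (f {Γ} c) ≡ f c)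
  (sub-f : ∀ {Γ Δ A} (θ : Sub {C = D} Γ Δ) (c : C A) → sub θ (f {Γ} c) ≡ f c) where

  mapCon-ren : ∀ {Γ Δ A} (ρ : Ren {C = C} Γ Δ) (t : Tm C Γ A) →
               mapCon f (ren ρ t) ≡ ren ρ (mapCon f t)
  mapCon-ren ρ (var x)   = refl
  mapCon-ren ρ (lam t)   =
    cong lam (trans (mapCon-ren (ext ρ) t)
                    (ren-cong (λ { here → refl ; (there x) → refl }) (mapCon f t)))
  mapCon-ren ρ (app t u) = cong₂ app (mapCon-ren ρ t) (mapCon-ren ρ u)
  mapCon-ren ρ (prim p)  = refl
  mapCon-ren ρ (con c)   = sym (ren-f ρ c)

  mapCon-sub : ∀ {Γ Δ A} (θ : Sub {C = C} Γ Δ) (t : Tm C Γ A) →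
               mapCon f (sub θ t) ≡ sub (mapCon f ∘ θ) (mapCon f t)
  mapCon-sub θ (var x)   = refl
  mapCon-sub θ (lam t)   =
    cong lam (trans (mapCon-sub (exts θ) t) (sub-cong mapCon-exts (mapCon f t)))
    where
    mapCon-exts : ∀ {B} → mapCon f ∘ exts {B = B} θ ≐ exts (mapCon f ∘ θ)
    mapCon-exts here      = refl
    mapCon-exts (there x) = mapCon-ren there (θ x)
  mapCon-sub θ (app t u) = cong₂ app (mapCon-sub θ t) (mapCon-sub θ u)
  mapCon-sub θ (prim p)  = refl
  mapCon-sub θ (con c)   = sym (sub-f _ c)

  mapCon-[] : ∀ {Γ A B} (t : Tm C (B ∷ Γ) A) (u : Tm C Γ B) →
              mapCon f (t [ u ]) ≡ mapCon f t [ mapCon f u ]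
  mapCon-[] t u = trans (mapCon-sub (sub₁ u) t)
                        (sub-cong (λ { here → refl ; (there x) → refl }) (mapCon f t))

  mapCon-num : ∀ {Γ} (n : ℕ) → mapCon f {Γ} (num n) ≡ num n
  mapCon-num zero    = refl
  mapCon-num (suc n) = cong (app (prim ‵S)) (mapCon-num n)

  mapCon-appNums : ∀ {Γ A k} (t : Tm C Γ (k ⇒ⁿ A)) (ns : Vec ℕ k) →
                   mapCon f (appNums t ns) ≡ appNums (mapCon f t) ns
  mapCon-appNums t []       = refl
  mapCon-appNums t (n ∷ ns) = trans (mapCon-appNums (app t (num n)) ns)
                                    (cong (λ m → appNums (app (mapCon f t) m) ns) (mapCon-num n))

-- Every closed predicate instance of T evaluates to True or False

module _ where
  open Red C₀ δ₀ using (β; ifT; ifF; R0; RS; π₀β; π₁β; ξappₗ; ξappᵣ)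

  Reducible₀ : (A : Ty false) → Tm₀ [] A → Set
  Reducible₀ nat     t = ∃[ n ] t ↠₀ num n
  Reducible₀ bool    t = (t ↠₀ prim ‵True) ⊎ (t ↠₀ prim ‵False)
  Reducible₀ (A ⇒ B) t = ∀ u → Reducible₀ A u → Reducible₀ B (app t u)
  Reducible₀ (A ⊗ B) t = Reducible₀ A (app (prim ‵π₀) t) × Reducible₀ B (app (prim ‵π₁) t)

  Reducible₀-expand : ∀ A {t t′} → t ↠₀ t′ → Reducible₀ A t′ → Reducible₀ A t
  Reducible₀-expand nat     r (n , r′)   = n , r ◅◅ r′
  Reducible₀-expand bool    r (inj₁ r′)  = inj₁ (r ◅◅ r′)
  Reducible₀-expand bool    r (inj₂ r′)  = inj₂ (r ◅◅ r′)
  Reducible₀-expand (A ⇒ B) r red u redᵤ =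
    Reducible₀-expand B (gmap (λ t → app t u) ξappₗ r) (red u redᵤ)
  Reducible₀-expand (A ⊗ B) r (red₀ , red₁) =
    Reducible₀-expand A (gmap (app (prim ‵π₀)) ξappᵣ r) red₀ ,
    Reducible₀-expand B (gmap (app (prim ‵π₁)) ξappᵣ r) red₁

  Reducible₀-R : ∀ A {u v} → Reducible₀ A u → Reducible₀ (nat ⇒ A ⇒ A) v →
                 ∀ k → Reducible₀ A (app (app (app (prim ‵R) u) v) (num k))
  Reducible₀-R A redᵤ redᵥ zero    = Reducible₀-expand A (R0 ◅ ε) redᵤ
  Reducible₀-R A redᵤ redᵥ (suc k) =
    Reducible₀-expand A (RS ◅ ε) (redᵥ (num k) (k , ε) _ (Reducible₀-R A redᵤ redᵥ k))

  Reducible₀-prim : ∀ {A} (p : Prim A) → Reducible₀ A (prim p)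
  Reducible₀-prim ‵0                = zero , ε
  Reducible₀-prim ‵S u (n , r)      = suc n , gmap (app (prim ‵S)) ξappᵣ r
  Reducible₀-prim ‵True             = inj₁ ε
  Reducible₀-prim ‵False            = inj₂ ε
  Reducible₀-prim (‵if {A}) b redb u redᵤ v redᵥ with redb
  ... | inj₁ r = Reducible₀-expand A (gmap _ (ξappₗ ∘ ξappₗ ∘ ξappᵣ) r ◅◅ ifT ◅ ε) redᵤ
  ... | inj₂ r = Reducible₀-expand A (gmap _ (ξappₗ ∘ ξappₗ ∘ ξappᵣ) r ◅◅ ifF ◅ ε) redᵥ
  Reducible₀-prim (‵R {A}) u redᵤ v redᵥ n (k , r) =
    Reducible₀-expand A (gmap _ ξappᵣ r) (Reducible₀-R A redᵤ redᵥ k)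
  Reducible₀-prim (‵pair {A} {B}) u redᵤ v redᵥ =
    Reducible₀-expand A (π₀β ◅ ε) redᵤ , Reducible₀-expand B (π₁β ◅ ε) redᵥ
  Reducible₀-prim ‵π₀ p (red₀ , _) = red₀
  Reducible₀-prim ‵π₁ p (_ , red₁) = red₁

  Reducible₀-sub : ∀ {Γ A} (t : Tm₀ Γ A) (θ : Sub Γ []) →
                   (∀ {B} (x : Γ ∋ B) → Reducible₀ B (θ x)) → Reducible₀ A (sub θ t)
  Reducible₀-sub (var x)   θ redθ = redθ x
  Reducible₀-sub {A = A ⇒ B} (lam t) θ redθ u redᵤ =
    Reducible₀-expand B (subst (app (lam (sub (exts θ) t)) u ↠₀_) (sub-exts-[] θ u t) (β ◅ ε))
      (Reducible₀-sub t (u ∷ₛ θ) λ { here → redᵤ ; (there x) → redθ x })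
  Reducible₀-sub (app t u) θ redθ = Reducible₀-sub t θ redθ (sub θ u) (Reducible₀-sub u θ redθ)
  Reducible₀-sub (prim p)  θ redθ = Reducible₀-prim p
  Reducible₀-sub (con ())  θ redθ

  Reducible₀-closed : ∀ {A} (t : Tm₀ [] A) → Reducible₀ A t
  Reducible₀-closed t = subst (Reducible₀ _) (sub-var t) (Reducible₀-sub t var λ ())

  Reducible₀-appNums : ∀ {k t} → Reducible₀ (k ⇒ⁿ bool) t → (ns : Vec ℕ k) →
                       Reducible₀ bool (appNums t ns)
  Reducible₀-appNums red []       = red
  Reducible₀-appNums red (n ∷ ns) = Reducible₀-appNums (red (num n) (n , ε)) ns

  pred-decided : ∀ {k} (P : Pred k) (ns : Vec ℕ k) →
                 (appNums (term P) ns ↠₀ prim ‵True) ⊎ (appNums (term P) ns ↠₀ prim ‵False)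
  pred-decided P = Reducible₀-appNums (Reducible₀-closed (term P))

_≟ty_ : DecidableEquality (Ty false)
nat     ≟ty nat       = yes refl
bool    ≟ty bool      = yes refl
(A ⇒ B) ≟ty (A′ ⇒ B′) with A ≟ty A′ | B ≟ty B′
... | yes refl | yes refl = yes refl
... | no A≢A′  | _        = no λ { refl → A≢A′ refl }
... | _        | no B≢B′  = no λ { refl → B≢B′ refl }
(A ⊗ B) ≟ty (A′ ⊗ B′) with A ≟ty A′ | B ≟ty B′
... | yes refl | yes refl = yes refl
... | no A≢A′  | _        = no λ { refl → A≢A′ refl }
... | _        | no B≢B′  = no λ { refl → B≢B′ refl }
nat     ≟ty bool    = no λ ()
nat     ≟ty (_ ⇒ _) = no λ ()
nat     ≟ty (_ ⊗ _) = no λ ()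
bool    ≟ty nat     = no λ ()
bool    ≟ty (_ ⇒ _) = no λ ()
bool    ≟ty (_ ⊗ _) = no λ ()
(_ ⇒ _) ≟ty nat     = no λ ()
(_ ⇒ _) ≟ty bool    = no λ ()
(_ ⇒ _) ≟ty (_ ⊗ _) = no λ ()
(_ ⊗ _) ≟ty nat     = no λ ()
(_ ⊗ _) ≟ty bool    = no λ ()
(_ ⊗ _) ≟ty (_ ⇒ _) = no λ ()

_≟∋_ : ∀ {Γ : Ctx false} {A} → DecidableEquality (Γ ∋ A)
here    ≟∋ here    = yes refl
here    ≟∋ there y = no λ ()
there x ≟∋ here    = no λ ()
there x ≟∋ there y with x ≟∋ y
... | yes refl = yes refl
... | no x≢y   = no λ { refl → x≢y refl }

_≟prim_ : ∀ {A : Ty false} → DecidableEquality (Prim A)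
‵0     ≟prim ‵0     = yes refl
‵S     ≟prim ‵S     = yes refl
‵True  ≟prim ‵True  = yes refl
‵True  ≟prim ‵False = no λ ()
‵False ≟prim ‵True  = no λ ()
‵False ≟prim ‵False = yes refl
‵if    ≟prim ‵if    = yes refl
‵R     ≟prim ‵R     = yes refl
‵pair  ≟prim ‵pair  = yes refl
‵π₀    ≟prim ‵π₀    = yes refl
‵π₀    ≟prim ‵π₁    = no λ ()
‵π₁    ≟prim ‵π₀    = no λ ()
‵π₁    ≟prim ‵π₁    = yes refl

_≟tm_ : ∀ {Γ A} → DecidableEquality (Tm₀ Γ A)
var x ≟tm var y with x ≟∋ y
... | yes refl = yes refl
... | no x≢y   = no λ { refl → x≢y refl }
lam t ≟tm lam u with t ≟tm u
... | yes refl = yes refl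
... | no t≢u   = no λ { refl → t≢u refl }
app {A = B} t u ≟tm app {A = B′} t′ u′ with B ≟ty B′
... | no B≢B′ = no λ { refl → B≢B′ refl }
... | yes refl with t ≟tm t′ | u ≟tm u′
...   | yes refl | yes refl = yes refl
...   | no t≢t′   | _        = no λ { refl → t≢t′ refl }
...   | _        | no u≢u′  = no λ { refl → u≢u′ refl }
prim p ≟tm prim q with p ≟prim q
... | yes refl = yes refl
... | no p≢q   = no λ { refl → p≢q refl }
var _   ≟tm lam _   = no λ ()
var _   ≟tm app _ _ = no λ ()
var _   ≟tm prim _  = no λ ()
lam _   ≟tm var _   = no λ ()
lam _   ≟tm app _ _ = no λ ()
lam _   ≟tm prim _  = no λ ()
app _ _ ≟tm var _   = no λ ()
app _ _ ≟tm lam _   = no λ ()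
app _ _ ≟tm prim _  = no λ ()
prim _  ≟tm var _   = no λ ()
prim _  ≟tm lam _   = no λ ()
prim _  ≟tm app _ _ = no λ ()
con () ≟tm _

_≟key_ : DecidableEquality Key
_≟key_ = Product.≡-dec _≟ℕ_ (Product.≡-dec _≟tm_ (Vec.≡-dec _≟ℕ_))

-- Joining states

Clashes : List Atom → Atom → Set
Clashes L a = ∃[ b ] (b ∈ L × Inconsistent b a)

inconsistent? : ∀ b a → Dec (Inconsistent b a)
inconsistent? b a with key b ≟key key a | val b ≟ℕ val a
... | yes κ≡ | no v≢ = yes (κ≡ , v≢)
... | yes _  | yes v≡ = no λ (_ , v≢) → v≢ v≡
... | no κ≢  | _      = no (κ≢ ∘ proj₁)

¬inconsistent⇒consistent : ∀ {b a} → ¬ Inconsistent b a → Consistent b a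
¬inconsistent⇒consistent {b} {a} ¬i κ≡ with val b ≟ℕ val a
... | yes v≡ = v≡
... | no v≢  = ⊥-elim (¬i (κ≡ , v≢))

clashes? : ∀ L a → Dec (Clashes L a)
clashes? L a = map′ find (λ (_ , b∈ , i) → lose b∈ i) (any? (λ b → inconsistent? b a) L)

filter-clashes : ∀ L₁ L₂ → ∃ (Filt L₁ L₂)
filter-clashes L₁ []       = [] , fnil
filter-clashes L₁ (a ∷ L₂) with clashes? L₁ a | filter-clashes L₁ L₂
... | yes c  | R , f = R , drop c f
... | no ¬c  | R , f = a ∷ R , keep ¬c f

module _ {L₁ : List Atom} where

  Filt-⊆ : ∀ {L₂ R a} → Filt L₁ L₂ R → a ∈ R → a ∈ L₂
  Filt-⊆ (keep _ f) (here refl) = here refl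
  Filt-⊆ (keep _ f) (there a∈)  = there (Filt-⊆ f a∈)
  Filt-⊆ (drop _ f) a∈          = there (Filt-⊆ f a∈)

  Filt-keeps : ∀ {L₂ R a} → Filt L₁ L₂ R → a ∈ L₂ → ¬ Clashes L₁ a → a ∈ R
  Filt-keeps (keep _ f) (here refl) ¬c = here refl
  Filt-keeps (keep _ f) (there a∈)  ¬c = there (Filt-keeps f a∈ ¬c)
  Filt-keeps (drop c f) (here refl) ¬c = ⊥-elim (¬c c)
  Filt-keeps (drop _ f) (there a∈)  ¬c = Filt-keeps f a∈ ¬c

  Filt-All : ∀ {P : Atom → Set} {L₂ R} → Filt L₁ L₂ R → All P L₂ → All P R
  Filt-All fnil       []       = []
  Filt-All (keep _ f) (p ∷ ps) = p ∷ Filt-All f ps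
  Filt-All (drop _ f) (_ ∷ ps) = Filt-All f ps

  Filt-AllPairs : ∀ {L₂ R} → Filt L₁ L₂ R → AllPairs Consistent L₂ → AllPairs Consistent R
  Filt-AllPairs fnil       []       = []
  Filt-AllPairs (keep _ f) (p ∷ ps) = Filt-All f p ∷ Filt-AllPairs f ps
  Filt-AllPairs (drop _ f) (_ ∷ ps) = Filt-AllPairs f ps

  Filt-consistent : ∀ {L₂ R b} → b ∈ L₁ → Filt L₁ L₂ R → All (Consistent b) R
  Filt-consistent b∈ fnil        = []
  Filt-consistent {b = b} b∈ (keep {a = a} ¬c f) =
    ¬inconsistent⇒consistent {b} {a} (λ i → ¬c (b , b∈ , i)) ∷ Filt-consistent b∈ f
  Filt-consistent b∈ (drop _ f)  = Filt-consistent b∈ f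

  Filt-++-consistent : ∀ {L₂ R} → Filt L₁ L₂ R →
                       AllPairs Consistent L₁ → AllPairs Consistent L₂ → AllPairs Consistent (L₁ ++ R)
  Filt-++-consistent f c₁ c₂ =
    AllPairs.++⁺ c₁ (Filt-AllPairs f c₂) (All.tabulate λ b∈ → Filt-consistent b∈ f)

infixl 6 _⊔ₛ_
_⊔ₛ_ : State → State → State
mkState L₁ c₁ ⊔ₛ mkState L₂ c₂ = mkState (L₁ ++ proj₁ F) (Filt-++-consistent (proj₂ F) c₁ c₂)
  where F = filter-clashes L₁ L₂

⊔ₛ-Filt : ∀ s₁ s₂ → Filt (atoms s₁) (atoms s₂) (proj₁ (filter-clashes (atoms s₁) (atoms s₂)))
⊔ₛ-Filt s₁ s₂ = proj₂ (filter-clashes (atoms s₁) (atoms s₂))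

⊔ₛ-step : ∀ {Γ} s₁ s₂ → LearnStep {Γ} (app (app (con ‵⊔) (con (st s₁))) (con (st s₂)))
                                       (con (st (s₁ ⊔ₛ s₂)))
⊔ₛ-step s₁ s₂ = join (⊔ₛ-Filt s₁ s₂) _

∈-⊔ₛ⁺ˡ : ∀ s₁ s₂ {a} → a ∈ atoms s₁ → a ∈ atoms (s₁ ⊔ₛ s₂)
∈-⊔ₛ⁺ˡ s₁ s₂ = ∈-++⁺ˡ

∈-⊔ₛ⁺ʳ : ∀ s₁ s₂ {a} → a ∈ atoms s₂ → ¬ HasKey s₁ (key a) → a ∈ atoms (s₁ ⊔ₛ s₂)
∈-⊔ₛ⁺ʳ s₁ s₂ a∈ ¬h =
  ∈-++⁺ʳ (atoms s₁) (Filt-keeps (⊔ₛ-Filt s₁ s₂) a∈ λ (b , b∈ , κ≡ , _) → ¬h (b , b∈ , κ≡))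

∈-⊔ₛ⁻ : ∀ s₁ s₂ {a} → a ∈ atoms (s₁ ⊔ₛ s₂) → a ∈ atoms s₁ ⊎ a ∈ atoms s₂
∈-⊔ₛ⁻ s₁ s₂ a∈ with ∈-++⁻ (atoms s₁) a∈
... | inj₁ a∈₁ = inj₁ a∈₁
... | inj₂ a∈R = inj₂ (Filt-⊆ (⊔ₛ-Filt s₁ s₂) a∈R)

hasKey? : ∀ s κ → Dec (HasKey s κ)
hasKey? s κ = map′ find (λ (_ , a∈ , κ≡) → lose a∈ κ≡) (any? (λ a → key a ≟key κ) (atoms s))

lookupKey : State → Key → Maybe ℕ
lookupKey s κ with hasKey? s κ
... | yes (a , _) = just (val a)
... | no _        = nothing

AllPairs-consistent-val : ∀ {L a b} → AllPairs Consistent L →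
                          a ∈ L → b ∈ L → key a ≡ key b → val a ≡ val b
AllPairs-consistent-val (c ∷ cs) (here refl) (here refl) κ≡ = refl
AllPairs-consistent-val (c ∷ cs) (here refl) (there b∈)  κ≡ = All.lookup c b∈ κ≡
AllPairs-consistent-val (c ∷ cs) (there a∈)  (here refl) κ≡ = sym (All.lookup c a∈ (sym κ≡))
AllPairs-consistent-val (c ∷ cs) (there a∈)  (there b∈)  κ≡ =
  AllPairs-consistent-val cs a∈ b∈ κ≡

-- Consistency is an irrelevant field of a state, so the equation is recomputed by deciding it.
consistent-val : ∀ s {a b} → a ∈ atoms s → b ∈ atoms s → key a ≡ key b → val a ≡ val b
consistent-val (mkState L c) {a} {b} a∈ b∈ κ≡ =
  recompute (val a ≟ℕ val b) (AllPairs-consistent-val c a∈ b∈ κ≡)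

data LookupView (s : State) (κ : Key) : Maybe ℕ → Set where
  present : ∀ {a} → a ∈ atoms s → key a ≡ κ → LookupView s κ (just (val a))
  absent  : ¬ HasKey s κ → LookupView s κ nothing

lookupKey-view : ∀ s κ → LookupView s κ (lookupKey s κ)
lookupKey-view s κ with hasKey? s κ
... | yes (_ , a∈ , κ≡) = present a∈ κ≡
... | no ¬h             = absent ¬h

lookupKey-mono : ∀ {s s′} → (∀ {a} → a ∈ atoms s → a ∈ atoms s′) →
                 ∀ κ {v} → lookupKey s κ ≡ just v → lookupKey s′ κ ≡ just v
lookupKey-mono {s} {s′} s⊆s′ κ eq with hasKey? s κ
... | yes (a , a∈ , κ≡) with refl ← eq with hasKey? s′ κ
...   | yes (b , b∈ , κ≡′) = cong just (consistent-val s′ b∈ (s⊆s′ a∈) (trans κ≡′ (sym κ≡)))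
...   | no ¬h              = ⊥-elim (¬h (a , s⊆s′ a∈ , κ≡))

-- Decision trees querying a state

data DTree (X : Set) : Set where
  leaf : X → DTree X
  ask  : Key → (Maybe ℕ → DTree X) → DTree X

run : ∀ {X} → DTree X → State → X
run (leaf x)  s = x
run (ask κ f) s = run (f (lookupKey s κ)) s

mapᵀ : ∀ {X Y} → (X → Y) → DTree X → DTree Y
mapᵀ g (leaf x)  = leaf (g x)
mapᵀ g (ask κ f) = ask κ (mapᵀ g ∘ f)

bindᵀ : ∀ {X Y} → DTree X → (X → DTree Y) → DTree Y
bindᵀ (leaf x)  g = g x
bindᵀ (ask κ f) g = ask κ (λ m → bindᵀ (f m) g)

run-mapᵀ : ∀ {X Y} (g : X → Y) d s → run (mapᵀ g d) s ≡ g (run d s)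
run-mapᵀ g (leaf x)  s = refl
run-mapᵀ g (ask κ f) s = run-mapᵀ g (f (lookupKey s κ)) s

run-bindᵀ : ∀ {X Y} d (g : X → DTree Y) s → run (bindᵀ d g) s ≡ run (g (run d s)) s
run-bindᵀ (leaf x)  g s = refl
run-bindᵀ (ask κ f) g s = run-bindᵀ (f (lookupKey s κ)) g s

-- Reducibility: every term of T_Class is decided by a decision tree

open Red ConstLearn LearnStep using (β; ifT; ifF; R0; RS; π₀β; π₁β; ξappₗ; ξappᵣ; δ⟶)

≡⇒↠L : ∀ {Γ A} {t u : TmLearn Γ A} → t ≡ u → t ↠L u
≡⇒↠L refl = ε

instC-ren : ∀ s {Γ Δ A} (ρ : Ren {C = ConstLearn} Γ Δ) (c : ConstClass A) →
            ren ρ (instC s {Γ} c) ≡ instC s c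
instC-ren s ρ (st _)   = refl
instC-ren s ρ (‵X _)   = refl
instC-ren s ρ (‵Φ _)   = refl
instC-ren s ρ (‵Add _) = refl
instC-ren s ρ ‵⊔       = refl

instC-sub : ∀ s {Γ Δ A} (θ : Sub {C = ConstLearn} Γ Δ) (c : ConstClass A) →
            sub θ (instC s {Γ} c) ≡ instC s c
instC-sub s θ (st _)   = refl
instC-sub s θ (‵X _)   = refl
instC-sub s θ (‵Φ _)   = refl
instC-sub s θ (‵Add _) = refl
instC-sub s θ ‵⊔       = refl

module Inst (s : State) = MapCon (instC s) (instC-ren s) (instC-sub s)

⟦num⟧ : ∀ s n → num {Γ = []} n ⟦ s ⟧ ≡ num n
⟦num⟧ s = Inst.mapCon-num s

Fresh : State → State → Set
Fresh e s = ∀ {a} → a ∈ atoms e → ¬ HasKey s (key a)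

Fresh-⊔ₛ : ∀ e₁ e₂ {s} → Fresh e₁ s → Fresh e₂ s → Fresh (e₁ ⊔ₛ e₂) s
Fresh-⊔ₛ e₁ e₂ fresh₁ fresh₂ a∈ with ∈-⊔ₛ⁻ e₁ e₂ a∈
... | inj₁ a∈₁ = fresh₁ a∈₁
... | inj₂ a∈₂ = fresh₂ a∈₂

boolTm : ∀ {Γ} → Bool → TmLearn Γ bool
boolTm true  = prim ‵True
boolTm false = prim ‵False

record Decided {A} {V : Set} (⌜_⌝ : V → TmLearn [] A) (Ok : V → State → Set)
               (t : TmClass [] A) : Set where
  constructor decided
  field
    tree    : DTree V
    reduces : ∀ s → t ⟦ s ⟧ ↠L ⌜ run tree s ⌝
    ok      : ∀ s → Ok (run tree s) s
open Decided

Trivial : ∀ {V : Set} → V → State → Set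
Trivial _ _ = ⊤

Reducible : (A : Ty true) → TmClass [] A → Set
Reducible nat     t = Decided num Trivial t
Reducible bool    t = Decided boolTm Trivial t
Reducible state   t = Decided (con ∘ st) Fresh t
Reducible (A ⇒ B) t = ∀ u → Reducible A u → Reducible B (app t u)
Reducible (A ⊗ B) t = Reducible A (app (prim ‵π₀) t) × Reducible B (app (prim ‵π₁) t)

ReducibleTm : Ty true → Set
ReducibleTm A = Σ (TmClass [] A) (Reducible A)

Decided-expand : ∀ {A V ⌜_⌝ Ok} {t t′ : TmClass [] A} → (∀ s → t ⟦ s ⟧ ↠L t′ ⟦ s ⟧) →
                 Decided {V = V} ⌜_⌝ Ok t′ → Decided ⌜_⌝ Ok t
Decided-expand r (decided d red ok) = decided d (λ s → r s ◅◅ red s) ok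

Decided-branch : ∀ {A V X ⌜_⌝ Ok} {t : TmClass [] A} (d : DTree X)
                 (g : X → Σ (TmClass [] A) (Decided {V = V} ⌜_⌝ Ok)) →
                 (∀ s → t ⟦ s ⟧ ↠L proj₁ (g (run d s)) ⟦ s ⟧) → Decided ⌜_⌝ Ok t
Decided-branch {⌜_⌝ = ⌜_⌝} {Ok} {t} d g r = decided d′ reduces′ ok′
  where
  d′ = bindᵀ d (tree ∘ proj₂ ∘ g)
  reduces′ : ∀ s → t ⟦ s ⟧ ↠L ⌜ run d′ s ⌝
  reduces′ s rewrite run-bindᵀ d (tree ∘ proj₂ ∘ g) s = r s ◅◅ reduces (proj₂ (g (run d s))) s
  ok′ : ∀ s → Ok (run d′ s) s
  ok′ s rewrite run-bindᵀ d (tree ∘ proj₂ ∘ g) s = ok (proj₂ (g (run d s))) s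

Reducible-expand : ∀ A {t t′} → (∀ s → t ⟦ s ⟧ ↠L t′ ⟦ s ⟧) → Reducible A t′ → Reducible A t
Reducible-expand nat     r red = Decided-expand r red
Reducible-expand bool    r red = Decided-expand r red
Reducible-expand state   r red = Decided-expand r red
Reducible-expand (A ⇒ B) r red u redᵤ =
  Reducible-expand B (λ s → gmap (λ f → app f (u ⟦ s ⟧)) ξappₗ (r s)) (red u redᵤ)
Reducible-expand (A ⊗ B) r (red₀ , red₁) =
  Reducible-expand A (λ s → gmap (app (prim ‵π₀)) ξappᵣ (r s)) red₀ ,
  Reducible-expand B (λ s → gmap (app (prim ‵π₁)) ξappᵣ (r s)) red₁

Reducible-branch : ∀ A {X} {t} (d : DTree X) (g : X → ReducibleTm A) →
                   (∀ s → t ⟦ s ⟧ ↠L proj₁ (g (run d s)) ⟦ s ⟧) → Reducible A t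
Reducible-branch nat     d g r = Decided-branch d g r
Reducible-branch bool    d g r = Decided-branch d g r
Reducible-branch state   d g r = Decided-branch d g r
Reducible-branch (A ⇒ B) d g r u redᵤ =
  Reducible-branch B d (λ x → app (proj₁ (g x)) u , proj₂ (g x) u redᵤ)
                       (λ s → gmap (λ f → app f (u ⟦ s ⟧)) ξappₗ (r s))
Reducible-branch (A ⊗ B) d g r =
  Reducible-branch A d (λ x → app (prim ‵π₀) (proj₁ (g x)) , proj₁ (proj₂ (g x)))
                       (λ s → gmap (app (prim ‵π₀)) ξappᵣ (r s)) ,
  Reducible-branch B d (λ x → app (prim ‵π₁) (proj₁ (g x)) , proj₂ (proj₂ (g x)))
                       (λ s → gmap (app (prim ‵π₁)) ξappᵣ (r s))

Reducible-num : ∀ n → Reducible nat (num n)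
Reducible-num n = decided (leaf n) (λ s → ≡⇒↠L (⟦num⟧ s n)) _

Reducible-R : ∀ A {u v} → Reducible A u → Reducible (nat ⇒ A ⇒ A) v →
              ∀ k → Reducible A (app (app (app (prim ‵R) u) v) (num k))
Reducible-R A redᵤ redᵥ zero    = Reducible-expand A (λ s → R0 ◅ ε) redᵤ
Reducible-R A redᵤ redᵥ (suc k) =
  Reducible-expand A (λ s → RS ◅ ε) (redᵥ (num k) (Reducible-num k) _ (Reducible-R A redᵤ redᵥ k))

Reducible-if : ∀ A {b} → Reducible bool b → (u v : ReducibleTm A) →
               Reducible A (app (app (app (prim ‵if) b) (proj₁ u)) (proj₁ v))
Reducible-if A {b} (decided d reduces _) u v = Reducible-branch A d select λ s →
  gmap _ (ξappₗ ∘ ξappₗ ∘ ξappᵣ) (reduces s) ◅◅ if-step s (run d s)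
  where
  select : Bool → ReducibleTm A
  select true  = u
  select false = v
  if-step : ∀ s x → app (app (app (prim ‵if) (boolTm x)) (proj₁ u ⟦ s ⟧)) (proj₁ v ⟦ s ⟧)
                    ↠L proj₁ (select x) ⟦ s ⟧
  if-step s true  = ifT ◅ ε
  if-step s false = ifF ◅ ε

Reducible-prim : ∀ {A} (p : Prim A) → Reducible A (prim p)
Reducible-prim ‵0     = decided (leaf zero) (λ s → ε) _
Reducible-prim ‵S u (decided d reduces _) = decided (mapᵀ suc d) S-reduces _
  where
  S-reduces : ∀ s → app (prim ‵S) (u ⟦ s ⟧) ↠L num (run (mapᵀ suc d) s)
  S-reduces s rewrite run-mapᵀ suc d s = gmap (app (prim ‵S)) ξappᵣ (reduces s)
Reducible-prim ‵True  = decided (leaf true) (λ s → ε) _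
Reducible-prim ‵False = decided (leaf false) (λ s → ε) _
Reducible-prim (‵if {A}) b redb u redᵤ v redᵥ = Reducible-if A redb (u , redᵤ) (v , redᵥ)
Reducible-prim (‵R {A}) u redᵤ v redᵥ n (decided d reduces _) =
  Reducible-branch A d (λ k → _ , Reducible-R A redᵤ redᵥ k) λ s →
    gmap _ ξappᵣ (reduces s) ◅◅ ≡⇒↠L (cong (app _) (sym (⟦num⟧ s (run d s))))
Reducible-prim (‵pair {A} {B}) u redᵤ v redᵥ =
  Reducible-expand A (λ s → π₀β ◅ ε) redᵤ , Reducible-expand B (λ s → π₁β ◅ ε) redᵥ
Reducible-prim ‵π₀ p (red₀ , _) = red₀
Reducible-prim ‵π₁ p (_ , red₁) = red₁

Reducible-curried : ∀ k {A} (t : TmClass [] (k ⇒ⁿ A)) →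
                    (∀ ns → Reducible A (appNums t ns)) → Reducible (k ⇒ⁿ A) t
Reducible-curried zero    t red = red []
Reducible-curried (suc k) {A} t red u (decided d reduces _) =
  Reducible-branch (k ⇒ⁿ A) d
    (λ m → app t (num m) , Reducible-curried k (app t (num m)) (red ∘ (m ∷_))) λ s →
    gmap _ ξappᵣ (reduces s) ◅◅ ≡⇒↠L (cong (app _) (sym (⟦num⟧ s (run d s))))

⟦appNums⟧ : ∀ s {A k} (t : TmClass [] (k ⇒ⁿ A)) ns → appNums t ns ⟦ s ⟧ ≡ appNums (t ⟦ s ⟧) ns
⟦appNums⟧ s {A} {k} t ns = Inst.mapCon-appNums s {A = A} {k = k} t ns

Reducible-X : ∀ {k} (P : Pred (suc k)) ns → Reducible bool (appNums (con (‵X P)) ns)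
Reducible-X {k} P ns = decided d (λ s → ≡⇒↠L (⟦appNums⟧ s (con (‵X P)) ns) ◅◅ χ-reduces s) _
  where
  κ = k , term P , ns
  d = ask κ (leaf ∘ is-just)
  χ-reduces : ∀ s → appNums (app (con (‵χ P)) (con (st s))) ns ↠L boolTm (run d s)
  χ-reduces s with lookupKey s κ | lookupKey-view s κ
  ... | _ | present a∈ κ≡ = δ⟶ (χ-yes (_ , a∈ , κ≡)) ◅ ε
  ... | _ | absent ¬h     = δ⟶ (χ-no ¬h) ◅ ε

Reducible-Φ : ∀ {k} (P : Pred (suc k)) ns → Reducible nat (appNums (con (‵Φ P)) ns)
Reducible-Φ {k} P ns = decided d (λ s → ≡⇒↠L (⟦appNums⟧ s (con (‵Φ P)) ns) ◅◅ φ-reduces s) _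
  where
  κ = k , term P , ns
  d = ask κ (leaf ∘ fromMaybe 0)
  φ-reduces : ∀ s → appNums (app (con (‵φ P)) (con (st s))) ns ↠L num (run d s)
  φ-reduces s with lookupKey s κ | lookupKey-view s κ
  ... | _ | present a∈ κ≡ = δ⟶ (φ-yes a∈ κ≡) ◅ ε
  ... | _ | absent ¬h     = δ⟶ (φ-no ¬h) ◅ ε

-- What add_P s n⃗ m reduces to when s has no atom with key (P, n⃗).
newAtom : ∀ {k} (P : Pred (suc k)) (ns : Vec ℕ k) (m : ℕ) → State
newAtom P ns m with pred-decided P (ns ∷ʳ m)
... | inj₁ holds = singleton (⟨ P , ns , m ⟩∣ holds)
... | inj₂ _     = ∅

Reducible-Add : ∀ {k} (P : Pred (suc k)) ns m → Reducible state (appNums (con (‵Add P)) (ns ∷ʳ m))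
Reducible-Add {k} P ns m =
  decided d (λ s → ≡⇒↠L (⟦appNums⟧ s (con (‵Add P)) (ns ∷ʳ m)) ◅◅ proj₁ (add-reduces s))
            (proj₂ ∘ add-reduces)
  where
  κ = k , term P , ns
  d = ask κ λ { nothing → leaf (newAtom P ns m) ; (just _) → leaf ∅ }
  add-reduces : ∀ s → (appNums (app (con (‵add P)) (con (st s))) (ns ∷ʳ m) ↠L con (st (run d s)))
                      × Fresh (run d s) s
  add-reduces s with lookupKey s κ | lookupKey-view s κ
  ... | _ | present a∈ κ≡ =
    δ⟶ (add-∅ {P = P} {s = s} {ns = ns} {m = m} (inj₁ (_ , a∈ , κ≡))) ◅ ε , λ ()
  ... | _ | absent ¬h with pred-decided P (ns ∷ʳ m)
  ...   | inj₁ holds = δ⟶ (add-new ¬h holds) ◅ ε , λ { (here refl) → ¬h }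
  ...   | inj₂ fails = δ⟶ (add-∅ {P = P} {s = s} {ns = ns} {m = m} (inj₂ fails)) ◅ ε , λ ()

Reducible-⊔ : Reducible (state ⇒ state ⇒ state) (con ‵⊔)
Reducible-⊔ u (decided d₁ reduces₁ fresh₁) v (decided d₂ reduces₂ fresh₂) =
  decided d (λ s → subst (λ e → _ ↠L con (st e)) (sym (run-d s)) (⊔-reduces s))
            (λ s → subst (λ e → Fresh e s) (sym (run-d s))
                         (Fresh-⊔ₛ (run d₁ s) (run d₂ s) {s} (fresh₁ s) (fresh₂ s)))
  where
  d = bindᵀ d₁ (λ e₁ → mapᵀ (e₁ ⊔ₛ_) d₂)
  run-d : ∀ s → run d s ≡ run d₁ s ⊔ₛ run d₂ s
  run-d s = trans (run-bindᵀ d₁ _ s) (run-mapᵀ _ d₂ s)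
  ⊔-reduces : ∀ s → app (app (con ‵⊔) (u ⟦ s ⟧)) (v ⟦ s ⟧) ↠L con (st (run d₁ s ⊔ₛ run d₂ s))
  ⊔-reduces s = gmap _ (ξappₗ ∘ ξappᵣ) (reduces₁ s) ◅◅ gmap _ ξappᵣ (reduces₂ s)
                ◅◅ δ⟶ (⊔ₛ-step (run d₁ s) (run d₂ s)) ◅ ε

Reducible-const : ∀ {A} (c : ConstClass A) → EmptyStateConst c → Reducible A (con c)
Reducible-const (st e) e≡∅ =
  decided (leaf e) (λ s → ε) λ s {a} a∈ → case subst (a ∈_) e≡∅ a∈ of λ ()
Reducible-const (‵X {k} P)   _ = Reducible-curried k (con (‵X P)) (Reducible-X P)
Reducible-const (‵Φ {k} P)   _ = Reducible-curried k (con (‵Φ P)) (Reducible-Φ P)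
Reducible-const (‵Add {k} P) _ = Reducible-curried (suc k) (con (‵Add P)) λ ns′ →
  let ns , m , ns′≡ = initLast ns′ in
  subst (Reducible state ∘ appNums (con (‵Add P))) (sym ns′≡) (Reducible-Add P ns m)
Reducible-const ‵⊔           _ = Reducible-⊔

Reducible-sub : ∀ {Γ A} (t : TmClass Γ A) → HasStateEmpty t → (θ : Sub Γ []) →
                (∀ {B} (x : Γ ∋ B) → Reducible B (θ x)) → Reducible A (sub θ t)
Reducible-sub (var x)   _ θ redθ = redθ x
Reducible-sub {A = A ⇒ B} (lam t) ∅t θ redθ u redᵤ =
  Reducible-expand B β-step (Reducible-sub t ∅t (u ∷ₛ θ) λ { here → redᵤ ; (there x) → redθ x })
  where
  open ≡-Reasoning
  β-step : ∀ s → app (lam (sub (exts θ) t ⟦ s ⟧)) (u ⟦ s ⟧) ↠L sub (u ∷ₛ θ) t ⟦ s ⟧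
  β-step s = β ◅ ≡⇒↠L (begin
    sub (exts θ) t ⟦ s ⟧ [ u ⟦ s ⟧ ]  ≡⟨ Inst.mapCon-[] s (sub (exts θ) t) u ⟨
    (sub (exts θ) t [ u ]) ⟦ s ⟧      ≡⟨ cong (_⟦ s ⟧) (sub-exts-[] θ u t) ⟩
    sub (u ∷ₛ θ) t ⟦ s ⟧              ∎)
Reducible-sub (app t u) (∅t , ∅u) θ redθ =
  Reducible-sub t ∅t θ redθ (sub θ u) (Reducible-sub u ∅u θ redθ)
Reducible-sub (prim p)  _ θ redθ = Reducible-prim p
Reducible-sub (con c)   ∅c θ redθ = Reducible-const c ∅c

Reducible-closed : ∀ {A} (t : TmClass [] A) → HasStateEmpty t → Reducible A t
Reducible-closed t ∅t = subst (Reducible _) (sub-var t) (Reducible-sub t ∅t var λ ())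

-- Convergence of learning

Increasing : (ℕ → State) → Set
Increasing σ = ∀ n {a} → a ∈ atoms (σ n) → a ∈ atoms (σ (suc n))

Increasing-≤′ : ∀ {σ} → Increasing σ →
                ∀ {m n a} → m ≤′ n → a ∈ atoms (σ m) → a ∈ atoms (σ n)
Increasing-≤′ inc ≤′-refl               a∈ = a∈
Increasing-≤′ {σ} inc (≤′-step {n} m≤′n) a∈ = inc n (Increasing-≤′ {σ} inc m≤′n a∈)

Stalled : State → State → State → Set
Stalled e s s′ = (∀ {a} → a ∈ atoms e → ¬ HasKey s′ (key a))
               ⊎ (∃[ a ] (a ∈ atoms e × HasKey s (key a)))

eventually-stalled : (d : DTree State) (σ : ℕ → State) → Increasing σ →
                     ∀ n → ∃[ m ] (n ≤′ m × Stalled (run d (σ m)) (σ m) (σ (suc m)))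
eventually-stalled (leaf e) σ inc n with any? (λ a → hasKey? (σ (suc n)) (key a)) (atoms e)
... | yes some = suc n , ≤′-step ≤′-refl , inj₂ (find some)
... | no none  = n , ≤′-refl , inj₁ λ a∈ h → none (lose a∈ h)
eventually-stalled (ask κ f) σ inc n with eventually-stalled (f nothing) σ inc n
... | m , n≤′m , stalled with lookupKey (σ m) κ in answer
...   | nothing =
  m , n≤′m , subst (λ r → Stalled (run (f r) (σ m)) (σ m) (σ (suc m))) (sym answer) stalled
...   | just v with eventually-stalled (f (just v)) σ inc m
...     | m′ , m≤′m′ , stalled′ =
  m′ , ≤′-trans n≤′m m≤′m′ ,
  subst (λ r → Stalled (run (f r) (σ m′)) (σ m′) (σ (suc m′)))
        (sym (lookupKey-mono (Increasing-≤′ {σ} inc m≤′m′) κ answer)) stalled′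

stalled-fresh-≡∅ : ∀ {e s} → Fresh e s → Stalled e s (s ⊔ₛ e) → e ≡ ∅
stalled-fresh-≡∅ {mkState [] _} fresh _ = refl
stalled-fresh-≡∅ {e@(mkState (a ∷ _) _)} {s} fresh (inj₁ unlearned) =
  ⊥-elim (unlearned (here refl) (a , ∈-⊔ₛ⁺ʳ s e (here refl) (fresh (here refl)) , refl))
stalled-fresh-≡∅ {mkState (_ ∷ _) _} fresh (inj₂ (_ , a∈ , h)) =
  ⊥-elim (fresh a∈ h)

learn : (State → State) → State → ℕ → State
learn g s zero    = s
learn g s (suc n) = learn g s n ⊔ₛ g (learn g s n)

learn-increasing : ∀ g s → Increasing (learn g s)
learn-increasing g s n = ∈-⊔ₛ⁺ˡ (learn g s n) (g (learn g s n))

Iter-learn : ∀ {t g} → (∀ s → t ⟦ s ⟧ ↠L con (st (g s))) → ∀ s n → Iter t s n (learn g s n)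
Iter-learn t↠g s zero    = base
Iter-learn t↠g s (suc n) = step (Iter-learn t↠g s n)
  (gmap _ ξappᵣ (t↠g (learn _ s n)) ◅◅ δ⟶ (⊔ₛ-step _ _) ◅ ε)

mainTheorem4 : (t : TmClass [] state) → HasStateEmpty t → (s : State)
    → ∃[ n ] ∃[ sₙ ] (Iter t s n sₙ × (t ⟦ sₙ ⟧ ↠L con (st ∅)))
mainTheorem4 t ∅t s =
  let decided d reduces fresh = Reducible-closed t ∅t
      m , _ , stalled         = eventually-stalled d (learn (run d) s) (learn-increasing _ s) 0
      sₘ                      = learn (run d) s m
  in  m , sₘ , Iter-learn reduces s m ,
      subst (λ e → t ⟦ sₘ ⟧ ↠L con (st e)) (stalled-fresh-≡∅ {run d sₘ} {sₘ} (fresh sₘ) stalled)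
            (reduces sₘ)
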